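{- Let $q$ be an indeterminate and define power series $F_r(x)\in\mathbf{Z}[q][[x]]$ with constant term $1$ by $F_1(x)=1-x$ and $F_{r+1}(x)=F_r(qx)/F_r(x)$ for $r\ge1$. Write $\widetilde{\chi}_r(n,q)\in\mathbf{Z}[q]$ for the coefficient of $x^n$ in $F_r(x)$. Then $q^{n-1}$ divides $\widetilde{\chi}_r(n,q)$ in $\mathbf{Z}[q]$ for every odd $r\ge 1$ and every $n\ge 1$.
   Context: For every prime power $q$, the evaluation of $\widetilde{\chi}_r(n,q)$ at $q$ equals the $r$th equivariant reduced Euler characteristic $\widetilde{\chi}_r(\mathrm{L}_n^*(\mathbf{F}_q),\mathrm{GL}_n(\mathbf{F}_q))=\frac{1}{|\mathrm{GL}_n(\mathbf{F}_q)|}\sum_{X\in\mathrm{Hom}(\mathbf{Z}^r,\mathrm{GL}_n(\mathbf{F}_q))}\widetilde{\chi}(C(X(\mathbf{Z}^r)))$, where $C(H)$ is the poset of $H$-invariant nonzero proper subspaces of $\mathbf{F}_q^n$ and $\widetilde{\chi}$ is the reduced Euler characteristic. -}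

module Defs where

open import Data.Nat using (ℕ; zero; suc; _∸_)
import Data.Nat as N
open import Data.Integer using (ℤ; +_; -_; _+_; _*_)
open import Data.List using (List; []; _∷_; map; upTo; zipWith; replicate; _++_; foldr)
open import Data.Product using (∃)
open import Relation.Binary.PropositionalEquality using (_≡_)

-- Z[q] : polynomials in q as coefficient lists (constant term first).
Poly : Set
Poly = List ℤ

coeff : Poly → ℕ → ℤ
coeff []       _       = + 0
coeff (a ∷ _)  zero    = a
coeff (_ ∷ as) (suc i) = coeff as i

addP : Poly → Poly → Poly
addP []       ys       = ys
addP xs       []       = xs
addP (x ∷ xs) (y ∷ ys) = (x + y) ∷ addP xs ys

negP : Poly → Poly
negP = map -_

scaleP : ℤ → Poly → Poly
scaleP c = map (c *_)

mulP : Poly → Poly → Poly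
mulP []       ys = []
mulP (x ∷ xs) ys = addP (scaleP x ys) (+ 0 ∷ mulP xs ys)

sumP : List Poly → Poly
sumP = foldr addP []

qPow : ℕ → Poly
qPow n = replicate n (+ 0) ++ (+ 1 ∷ [])

-- divisibility in Z[q]: d ∣ p iff p = d * g for some g (equality of polynomials = equal coefficients)
_∣P_ : Poly → Poly → Set
d ∣P p = ∃ λ (g : Poly) → ∀ i → coeff p i ≡ coeff (mulP d g) i

-- Z[q][[x]] : power series in x, coefficient of x^n given by a polynomial in q
Series : Set
Series = ℕ → Poly

mulS : Series → Series → Series
mulS f g n = sumP (map (λ k → mulP (f k) (g (n ∸ k))) (upTo (suc n)))

substQ : Series → Series
substQ f n = mulP (qPow n) (f n)

-- reversed list [g_n, ..., g_0] of coefficients of 1/f, for f with constant term 1: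
-- g_0 = 1, g_{n+1} = - Σ_{k=1}^{n+1} f_k g_{n+1-k}
invRev : Series → ℕ → List Poly
invRev f zero    = (+ 1 ∷ []) ∷ []
invRev f (suc n) =
  let gs = invRev f n in
  negP (sumP (zipWith mulP (map (λ k → f (suc k)) (upTo (suc n))) gs)) ∷ gs

headD : List Poly → Poly
headD []      = []
headD (p ∷ _) = p

invS : Series → Series
invS f n = headD (invRev f n)

oneMinusX : Series
oneMinusX zero          = + 1 ∷ []
oneMinusX (suc zero)    = - (+ 1) ∷ []
oneMinusX (suc (suc _)) = []

-- Fsh r = F_{r+1}:  F_1 = 1 - x,  F_{r+1}(x) = F_r(qx) / F_r(x)
Fsh : ℕ → Series
Fsh zero    = oneMinusX
Fsh (suc r) = mulS (substQ (Fsh r)) (invS (Fsh r))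

-- χ̃_r(n,q) = coefficient of x^n in F_r(x)  (r ≥ 1; value at r = 0 is junk)
chi : ℕ → ℕ → Poly
chi zero    n = []
chi (suc r) n = Fsh r n

Odd : ℕ → Set
Odd r = ∃ λ m → r ≡ suc (2 N.* m)

module Submission where

-- Work in R[[q]][[x]] for a commutative ring R.  Call a series q-scaled when qⁿ
-- divides its coefficient of xⁿ, i.e. it has the form g(qx).  Such series are
-- closed under products, contain f(qx) for every f, and contain the inverse of
-- any q-scaled series with constant term 1.  The F_r alternate between two shapes:
--   r odd:   F_r = (1 − x)·A   with A q-scaled,
--   r even:  F_r·(1 − x) = B   with B q-scaled,
-- because F_{r+1} = F_r(qx)·F_r⁻¹ turns (1 − x)A into F_r(qx)·A⁻¹·(1 − x)⁻¹ and
-- B(1 − x)⁻¹ into (1 − x)·F_r(qx)·B⁻¹.  For odd r the coefficient of xⁿ is then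
-- Aₙ − Aₙ₋₁, divisible by q^(n-1).

open import Defs
open import Data.Nat using (ℕ; _≤_; _∸_)

open import Level using (Level)
open import Algebra.Bundles using (CommutativeRing)
open import Data.Nat as ℕ using (zero; suc; _<_; z≤n; s≤s)
import Data.Nat.Properties as ℕₚ
open import Data.Product using (_,_)
import Relation.Binary.Reasoning.Setoid as SetoidReasoning
import Algebra.Properties.CommutativeSemigroup as CommSemigroupProperties
import Relation.Binary.PropositionalEquality as ≡


-- Formal power series ∑ f n xⁿ over a commutative ring R, represented by their
-- coefficient functions, with the Cauchy product defined by recursion on the
-- index: (a·b)ₙ₊₁ = a₀ bₙ₊₁ + ((a − a₀)/x · b)ₙ.
module PowerSeries {c ℓ : Level} (R : CommutativeRing c ℓ) where
  open CommutativeRing R renaming (Carrier to A) hiding (zero)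
  open SetoidReasoning setoid

  infix 4 _≋_
  infixl 6 _⊕_
  infixl 7 _⊛_
  infix 8 ⊖_

  Ser : Set c
  Ser = ℕ → A

  _≋_ : Ser → Ser → Set ℓ
  f ≋ g = ∀ n → f n ≈ g n

  tl : Ser → Ser
  tl f n = f (suc n)

  _⊕_ : Ser → Ser → Ser
  (f ⊕ g) n = f n + g n

  ⊖_ : Ser → Ser
  (⊖ f) n = - (f n)

  𝟘 : Ser
  𝟘 n = 0#

  𝟙 : Ser
  𝟙 zero    = 1#
  𝟙 (suc n) = 0#

  _⊛_ : Ser → Ser → Ser
  (a ⊛ b) zero    = a 0 * b 0
  (a ⊛ b) (suc n) = a 0 * b (suc n) + (tl a ⊛ b) n

  ⊛-cong : ∀ {a a′ b b′} → a ≋ a′ → b ≋ b′ → a ⊛ b ≋ a′ ⊛ b′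
  ⊛-cong p q zero    = *-cong (p 0) (q 0)
  ⊛-cong p q (suc n) = +-cong (*-cong (p 0) (q (suc n))) (⊛-cong (λ m → p (suc m)) q n)

  ⊛-zeroˡ : ∀ b → 𝟘 ⊛ b ≋ 𝟘
  ⊛-zeroˡ b zero    = zeroˡ (b 0)
  ⊛-zeroˡ b (suc n) = trans (+-cong (zeroˡ _) (⊛-zeroˡ b n)) (+-identityˡ 0#)

  ⊛-distribʳ : ∀ a b c → (a ⊕ b) ⊛ c ≋ a ⊛ c ⊕ b ⊛ c
  ⊛-distribʳ a b c zero    = distribʳ (c 0) (a 0) (b 0)
  ⊛-distribʳ a b c (suc n) = begin
      (a 0 + b 0) * c (suc n) + ((tl a ⊕ tl b) ⊛ c) n
    ≈⟨ +-cong (distribʳ _ _ _) (⊛-distribʳ (tl a) (tl b) c n) ⟩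
      (a 0 * c (suc n) + b 0 * c (suc n)) + ((tl a ⊛ c) n + (tl b ⊛ c) n)
    ≈⟨ CommSemigroupProperties.interchange +-commutativeSemigroup _ _ _ _ ⟩
      (a 0 * c (suc n) + (tl a ⊛ c) n) + (b 0 * c (suc n) + (tl b ⊛ c) n) ∎

  ⊛-distribˡ : ∀ a b c → a ⊛ (b ⊕ c) ≋ a ⊛ b ⊕ a ⊛ c
  ⊛-distribˡ a b c zero    = distribˡ (a 0) (b 0) (c 0)
  ⊛-distribˡ a b c (suc n) = begin
      a 0 * (b (suc n) + c (suc n)) + (tl a ⊛ (b ⊕ c)) n
    ≈⟨ +-cong (distribˡ _ _ _) (⊛-distribˡ (tl a) b c n) ⟩
      (a 0 * b (suc n) + a 0 * c (suc n)) + ((tl a ⊛ b) n + (tl a ⊛ c) n)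
    ≈⟨ CommSemigroupProperties.interchange +-commutativeSemigroup _ _ _ _ ⟩
      (a 0 * b (suc n) + (tl a ⊛ b) n) + (a 0 * c (suc n) + (tl a ⊛ c) n) ∎

  ⊛-scaleˡ : ∀ k a b → (λ n → k * a n) ⊛ b ≋ (λ n → k * (a ⊛ b) n)
  ⊛-scaleˡ k a b zero    = *-assoc _ _ _
  ⊛-scaleˡ k a b (suc n) =
    trans (+-cong (*-assoc _ _ _) (⊛-scaleˡ k (tl a) b n)) (sym (distribˡ _ _ _))

  ⊛-assoc : ∀ a b c → (a ⊛ b) ⊛ c ≋ a ⊛ (b ⊛ c)
  ⊛-assoc a b c zero    = *-assoc _ _ _
  ⊛-assoc a b c (suc n) = begin
      (a 0 * b 0) * c (suc n) + (tl (a ⊛ b) ⊛ c) n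
    ≈⟨ +-cong refl (⊛-distribʳ (λ m → a 0 * tl b m) (tl a ⊛ b) c n) ⟩
      (a 0 * b 0) * c (suc n) + (((λ m → a 0 * tl b m) ⊛ c) n + ((tl a ⊛ b) ⊛ c) n)
    ≈⟨ +-cong refl (+-cong (⊛-scaleˡ (a 0) (tl b) c n) (⊛-assoc (tl a) b c n)) ⟩
      (a 0 * b 0) * c (suc n) + (a 0 * (tl b ⊛ c) n + (tl a ⊛ (b ⊛ c)) n)
    ≈⟨ sym (+-assoc _ _ _) ⟩
      ((a 0 * b 0) * c (suc n) + a 0 * (tl b ⊛ c) n) + (tl a ⊛ (b ⊛ c)) n
    ≈⟨ +-cong (trans (+-cong (*-assoc _ _ _) refl) (sym (distribˡ _ _ _))) refl ⟩
      a 0 * (b 0 * c (suc n) + (tl b ⊛ c) n) + (tl a ⊛ (b ⊛ c)) n ∎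

  ⊛-peelʳ : ∀ a b n → (a ⊛ b) (suc n) ≈ (a ⊛ tl b) n + a (suc n) * b 0
  ⊛-peelʳ a b zero    = refl
  ⊛-peelʳ a b (suc n) = trans (+-cong refl (⊛-peelʳ (tl a) b n)) (sym (+-assoc _ _ _))

  ⊛-comm : ∀ a b → a ⊛ b ≋ b ⊛ a
  ⊛-comm a b zero    = *-comm _ _
  ⊛-comm a b (suc n) = begin
      a 0 * b (suc n) + (tl a ⊛ b) n   ≈⟨ +-cong (*-comm _ _) (⊛-comm (tl a) b n) ⟩
      b (suc n) * a 0 + (b ⊛ tl a) n   ≈⟨ +-comm _ _ ⟩
      (b ⊛ tl a) n + b (suc n) * a 0   ≈⟨ sym (⊛-peelʳ b a n) ⟩
      (b ⊛ a) (suc n)                   ∎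

  ⊛-identityˡ : ∀ a → 𝟙 ⊛ a ≋ a
  ⊛-identityˡ a zero    = *-identityˡ _
  ⊛-identityˡ a (suc n) = trans (+-cong (*-identityˡ _) (⊛-zeroˡ a n)) (+-identityʳ _)

  ⊛-identityʳ : ∀ a → a ⊛ 𝟙 ≋ a
  ⊛-identityʳ a n = trans (⊛-comm a 𝟙 n) (⊛-identityˡ a n)

  serRing : CommutativeRing c ℓ
  serRing = record
    { Carrier = Ser ; _≈_ = _≋_ ; _+_ = _⊕_ ; _*_ = _⊛_ ; -_ = ⊖_ ; 0# = 𝟘 ; 1# = 𝟙
    ; isCommutativeRing = record
      { isRing = record
        { +-isAbelianGroup = record
          { isGroup = record
            { isMonoid = record
              { isSemigroup = record
                { isMagma = record
                  { isEquivalence = record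
                    { refl = λ n → refl ; sym = λ p n → sym (p n) ; trans = λ p q n → trans (p n) (q n) }
                  ; ∙-cong = λ p q n → +-cong (p n) (q n) }
                ; assoc = λ f g h n → +-assoc _ _ _ }
              ; identity = (λ f n → +-identityˡ _) , (λ f n → +-identityʳ _) }
            ; inverse = (λ f n → -‿inverseˡ _) , (λ f n → -‿inverseʳ _)
            ; ⁻¹-cong = λ p n → -‿cong (p n) }
          ; comm = λ f g n → +-comm _ _ }
        ; *-cong = ⊛-cong
        ; *-assoc = ⊛-assoc
        ; *-identity = ⊛-identityˡ , ⊛-identityʳ
        ; distrib = ⊛-distribˡ , (λ c a b → ⊛-distribʳ a b c) }
      ; *-comm = ⊛-comm } }

  VanishBelow : ℕ → Ser → Set ℓ
  VanishBelow m f = ∀ i → i < m → f i ≈ 0#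

  vanish-resp : ∀ {m f g} → f ≋ g → VanishBelow m f → VanishBelow m g
  vanish-resp f≋g vf i i<m = trans (sym (f≋g i)) (vf i i<m)

  vanish-weaken : ∀ {k m f} → k ≤ m → VanishBelow m f → VanishBelow k f
  vanish-weaken k≤m vf i i<k = vf i (ℕₚ.<-≤-trans i<k k≤m)

  vanish-≡ : ∀ {m k f} → m ≡.≡ k → VanishBelow m f → VanishBelow k f
  vanish-≡ ≡.refl vf = vf

  vanish-⊕ : ∀ {m f g} → VanishBelow m f → VanishBelow m g → VanishBelow m (f ⊕ g)
  vanish-⊕ vf vg i i<m = trans (+-cong (vf i i<m) (vg i i<m)) (+-identityʳ 0#)

  vanish-⊖ : ∀ {m f} → VanishBelow m f → VanishBelow m (⊖ f)
  vanish-⊖ vf i i<m = trans (-‿cong (vf i i<m)) ε⁻¹≈ε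
    where open import Algebra.Properties.AbelianGroup +-abelianGroup using (ε⁻¹≈ε)

  private
    zero*-left : ∀ {x} y → x ≈ 0# → x * y ≈ 0#
    zero*-left y x≈0 = trans (*-cong x≈0 refl) (zeroˡ y)

    zero*-right : ∀ x {y} → y ≈ 0# → x * y ≈ 0#
    zero*-right x y≈0 = trans (*-cong refl y≈0) (zeroʳ x)

    zero+zero : ∀ {x y} → x ≈ 0# → y ≈ 0# → x + y ≈ 0#
    zero+zero x≈0 y≈0 = trans (+-cong x≈0 y≈0) (+-identityʳ 0#)

  vanish-⊛ : ∀ a b {f g} → VanishBelow a f → VanishBelow b g → VanishBelow (a ℕ.+ b) (f ⊛ g)
  vanish-⊛ zero    b {f} vf vg zero    i<b = zero*-right (f 0) (vg 0 i<b)
  vanish-⊛ zero    b {f} vf vg (suc i) i<b =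
    zero+zero (zero*-right (f 0) (vg (suc i) i<b))
              (vanish-⊛ zero b {tl f} (λ _ ()) vg i (ℕₚ.<-trans (ℕₚ.n<1+n i) i<b))
  vanish-⊛ (suc a) b {f} {g} vf vg zero    _ = zero*-left (g 0) (vf 0 (s≤s z≤n))
  vanish-⊛ (suc a) b {f} {g} vf vg (suc i) (s≤s i<a+b) =
    zero+zero (zero*-left (g (suc i)) (vf 0 (s≤s z≤n)))
              (vanish-⊛ a b {tl f} (λ j j<a → vf (suc j) (s≤s j<a)) vg i i<a+b)

  xPow : ℕ → Ser
  xPow zero    i       = 𝟙 i
  xPow (suc k) zero    = 0#
  xPow (suc k) (suc i) = xPow k i

  xPow-vanish : ∀ k b → VanishBelow k (xPow k ⊛ b)
  xPow-vanish (suc k) b zero    _         = zeroˡ (b 0)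
  xPow-vanish (suc k) b (suc i) (s≤s i<k) = zero+zero (zeroˡ (b (suc i))) (xPow-vanish k b i i<k)

  xPow-factor : ∀ k {f} → VanishBelow k f → f ≋ xPow k ⊛ (λ j → f (k ℕ.+ j))
  xPow-factor zero    {f} _  i       = sym (⊛-identityˡ f i)
  xPow-factor (suc k) {f} vf zero    = trans (vf 0 (s≤s z≤n)) (sym (zeroˡ _))
  xPow-factor (suc k) {f} vf (suc i) = begin
    f (suc i)                                                ≈⟨ xPow-factor k {tl f} (λ j j<k → vf (suc j) (s≤s j<k)) i ⟩
    (xPow k ⊛ (λ j → f (suc k ℕ.+ j))) i                     ≈⟨ sym (+-identityˡ _) ⟩
    0# + (xPow k ⊛ (λ j → f (suc k ℕ.+ j))) i                ≈⟨ +-cong (sym (zeroˡ _)) refl ⟩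
    0# * f (suc k ℕ.+ suc i) + (xPow k ⊛ (λ j → f (suc k ℕ.+ j))) i ∎

  -- Inverses of series with constant term 1 are characterised by the recursion
  -- gₙ₊₁ = −((f − f₀)/x · g)ₙ, which is how  invS  in Defs computes them.
  recursion⇒inverse : ∀ {f g} → f 0 ≈ 1# → g 0 ≈ 1# →
                      (∀ n → g (suc n) ≈ - (tl f ⊛ g) n) → f ⊛ g ≋ 𝟙
  recursion⇒inverse f₀≈1 g₀≈1 rec zero    = trans (*-cong f₀≈1 g₀≈1) (*-identityˡ 1#)
  recursion⇒inverse {f} {g} f₀≈1 g₀≈1 rec (suc n) = begin
      f 0 * g (suc n) + (tl f ⊛ g) n     ≈⟨ +-cong (trans (*-cong f₀≈1 (rec n)) (*-identityˡ _)) refl ⟩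
      - (tl f ⊛ g) n + (tl f ⊛ g) n      ≈⟨ -‿inverseˡ _ ⟩
      0#                                 ∎

  inverse⇒recursion : ∀ {f g} → f 0 ≈ 1# → f ⊛ g ≋ 𝟙 →
                      ∀ n → g (suc n) ≈ - (tl f ⊛ g) n
  inverse⇒recursion {f} {g} f₀≈1 fg≈1 n = inverseˡ-unique (g (suc n)) ((tl f ⊛ g) n) (begin
      g (suc n) + (tl f ⊛ g) n           ≈⟨ +-cong (sym (trans (*-cong f₀≈1 refl) (*-identityˡ _))) refl ⟩
      f 0 * g (suc n) + (tl f ⊛ g) n     ≈⟨ fg≈1 (suc n) ⟩
      0#                                 ∎)
    where open import Algebra.Properties.Group +-group using (inverseˡ-unique)

  𝟙-x : Ser
  𝟙-x zero          = 1#
  𝟙-x (suc zero)    = - 1#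
  𝟙-x (suc (suc n)) = 0#

  geometric : Ser
  geometric n = 1#

  𝟙-x-⊛-zero : ∀ a → (𝟙-x ⊛ a) 0 ≈ a 0
  𝟙-x-⊛-zero a = *-identityˡ (a 0)

  𝟙-x-⊛-suc : ∀ a k → (𝟙-x ⊛ a) (suc k) ≈ a (suc k) + - a k
  𝟙-x-⊛-suc a k = +-cong (*-identityˡ (a (suc k))) (minus-x-⊛ k)
    where
    open import Algebra.Properties.Ring ring using (-1*x≈-x)

    minus-x-⊛ : ∀ n → (tl 𝟙-x ⊛ a) n ≈ - a n
    minus-x-⊛ zero    = -1*x≈-x (a 0)
    minus-x-⊛ (suc n) = begin
      - 1# * a (suc n) + (tl (tl 𝟙-x) ⊛ a) n  ≈⟨ +-cong (-1*x≈-x _) (⊛-zeroˡ a n) ⟩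
      - a (suc n) + 0#                        ≈⟨ +-identityʳ _ ⟩
      - a (suc n)                             ∎

  𝟙-x-⊛-geometric : 𝟙-x ⊛ geometric ≋ 𝟙
  𝟙-x-⊛-geometric zero    = 𝟙-x-⊛-zero geometric
  𝟙-x-⊛-geometric (suc n) = trans (𝟙-x-⊛-suc geometric n) (-‿inverseʳ 1#)

-- Power series in x whose coefficients are power series in q, i.e. R[[q]][[x]].
module DoubleSeries {c ℓ : Level} (R : CommutativeRing c ℓ) where
  module Q = PowerSeries R
  module X = PowerSeries Q.serRing
  module QR = CommutativeRing Q.serRing
  module XR = CommutativeRing X.serRing

  open import Data.Product using (Σ; _×_)
  open import Data.Sum using (inj₁; inj₂)
  open import Relation.Binary.PropositionalEquality using (_≡_; refl; cong; sym; trans)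
  open import Algebra.Solver.CommutativeMonoid XR.*-commutativeMonoid using (solve; _⊜_; _⊕_)

  -- f(x) ↦ f(qx): the coefficient of xⁿ is multiplied by qⁿ.
  dilate : X.Ser → X.Ser
  dilate f n = Q.xPow n Q.⊛ f n

  Scaled : X.Ser → Set ℓ
  Scaled f = ∀ n → Q.VanishBelow n (f n)

  scaled-resp : ∀ {f g} → f X.≋ g → Scaled f → Scaled g
  scaled-resp f≋g sf n = Q.vanish-resp (f≋g n) (sf n)

  𝟙-scaled : Scaled X.𝟙
  𝟙-scaled zero    i ()
  𝟙-scaled (suc n) i _ = CommutativeRing.refl R

  dilate-scaled : ∀ f → Scaled (dilate f)
  dilate-scaled f n = Q.xPow-vanish n (f n)

  ⊛-divisibility : ∀ N a b f g →
    (∀ k → k ≤ N → Q.VanishBelow (k ℕ.+ a) (f k)) →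
    (∀ k → k ≤ N → Q.VanishBelow (k ℕ.+ b) (g k)) →
    Q.VanishBelow (N ℕ.+ a ℕ.+ b) ((f X.⊛ g) N)
  ⊛-divisibility zero    a b f g df dg = Q.vanish-⊛ a b (df 0 z≤n) (dg 0 z≤n)
  ⊛-divisibility (suc N) a b f g df dg = Q.vanish-⊕
    (Q.vanish-≡ (reorder a (suc N) b)
      (Q.vanish-⊛ a (suc N ℕ.+ b) (df 0 z≤n) (dg (suc N) ℕₚ.≤-refl)))
    (Q.vanish-≡ (cong (ℕ._+ b) (ℕₚ.+-suc N a))
      (⊛-divisibility N (suc a) b (X.tl f) g
        (λ k k≤N → Q.vanish-≡ (sym (ℕₚ.+-suc k a)) (df (suc k) (s≤s k≤N)))
        (λ k k≤N → dg k (ℕₚ.m≤n⇒m≤1+n k≤N))))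
    where
    reorder : ∀ a n b → a ℕ.+ (n ℕ.+ b) ≡ n ℕ.+ a ℕ.+ b
    reorder a n b = trans (sym (ℕₚ.+-assoc a n b)) (cong (ℕ._+ b) (ℕₚ.+-comm a n))

  scaled-⊛ : ∀ {f g} → Scaled f → Scaled g → Scaled (f X.⊛ g)
  scaled-⊛ {f} {g} sf sg n = Q.vanish-≡ (trans (ℕₚ.+-identityʳ _) (ℕₚ.+-identityʳ n))
    (⊛-divisibility n 0 0 f g (λ k _ → padded (sf k)) (λ k _ → padded (sg k)))
    where
    padded : ∀ {k p} → Q.VanishBelow k p → Q.VanishBelow (k ℕ.+ 0) p
    padded {k} = Q.vanish-≡ (sym (ℕₚ.+-identityʳ k))

  -- The inverse of a q-scaled series with constant term 1 is q-scaled: by the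
  -- recursion hₙ₊₁ = −((A − A₀)/x · h)ₙ and strong induction on n.
  scaled-inverse : ∀ {A h} → Scaled A → A 0 Q.≋ Q.𝟙 → A X.⊛ h X.≋ X.𝟙 → Scaled h
  scaled-inverse {A} {h} sA A₀≈1 Ah≈1 n = below n n ℕₚ.≤-refl
    where
    below : ∀ n k → k ≤ n → Q.VanishBelow k (h k)
    below zero    zero    z≤n     i ()
    below (suc n) k       k≤1+n   with ℕₚ.m≤n⇒m<n∨m≡n k≤1+n
    ... | inj₁ (s≤s k≤n) = below n k k≤n
    ... | inj₂ refl      = Q.vanish-resp (QR.sym (X.inverse⇒recursion A₀≈1 Ah≈1 n)) (Q.vanish-⊖
            (Q.vanish-≡ (trans (ℕₚ.+-identityʳ _) (ℕₚ.+-comm n 1))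
              (⊛-divisibility n 1 0 (X.tl A) h
                (λ j _ → Q.vanish-≡ (ℕₚ.+-comm 1 j) (sA (suc j)))
                (λ j j≤n → Q.vanish-≡ (sym (ℕₚ.+-identityʳ j)) (below n j j≤n)))))

  OddShape : X.Ser → Set (c Level.⊔ ℓ)
  OddShape F = Σ X.Ser λ A → Scaled A × F X.≋ X.𝟙-x X.⊛ A

  EvenShape : X.Ser → Set (c Level.⊔ ℓ)
  EvenShape F = Σ X.Ser λ B → Scaled B × F X.⊛ X.𝟙-x X.≋ B

  module Step {F J G : X.Ser} (F₀≈1 : F 0 Q.≋ Q.𝟙) (FJ≈1 : F X.⊛ J X.≋ X.𝟙)
              (G≋ : G X.≋ dilate F X.⊛ J) where

    -- F = (1 − x)A  gives  G(1 − x) = F(qx)·A⁻¹, and A⁻¹ = J(1 − x) is q-scaled.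
    odd⇒even : OddShape F → EvenShape G
    odd⇒even (A , sA , F≋) = G X.⊛ X.𝟙-x , scaled-resp (XR.sym G𝟙-x≋) scaled , XR.refl
      where
      A₀≈1 : A 0 Q.≋ Q.𝟙
      A₀≈1 = QR.trans (QR.sym (X.𝟙-x-⊛-zero A)) (QR.trans (QR.sym (F≋ 0)) F₀≈1)
      A⊛J𝟙-x≈1 : A X.⊛ (J X.⊛ X.𝟙-x) X.≋ X.𝟙
      A⊛J𝟙-x≈1 = XR.trans (solve 3 (λ a j l → a ⊕ (j ⊕ l) ⊜ (l ⊕ a) ⊕ j) XR.refl A J X.𝟙-x)
                   (XR.trans (XR.*-cong (XR.sym F≋) XR.refl) FJ≈1)
      G𝟙-x≋ : G X.⊛ X.𝟙-x X.≋ dilate F X.⊛ (J X.⊛ X.𝟙-x)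
      G𝟙-x≋ = XR.trans (XR.*-cong G≋ XR.refl) (XR.*-assoc _ _ _)
      scaled : Scaled (dilate F X.⊛ (J X.⊛ X.𝟙-x))
      scaled = scaled-⊛ (dilate-scaled F) (scaled-inverse sA A₀≈1 A⊛J𝟙-x≈1)

    -- F(1 − x) = B  gives  G = (1 − x)·F(qx)·B⁻¹, and B⁻¹ = J·∑xⁿ is q-scaled.
    even⇒odd : EvenShape F → OddShape G
    even⇒odd (B , sB , F𝟙-x≋) = dilate F X.⊛ (J X.⊛ X.geometric) , scaled , G≋′
      where
      B₀≈1 : B 0 Q.≋ Q.𝟙
      B₀≈1 = QR.trans (QR.sym (F𝟙-x≋ 0)) (QR.trans (QR.*-cong F₀≈1 QR.refl) (QR.*-identityˡ _))
      B⊛Jgeom≈1 : B X.⊛ (J X.⊛ X.geometric) X.≋ X.𝟙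
      B⊛Jgeom≈1 = XR.trans (XR.*-cong (XR.sym F𝟙-x≋) XR.refl)
        (XR.trans (solve 4 (λ f l j e → (f ⊕ l) ⊕ (j ⊕ e) ⊜ (f ⊕ j) ⊕ (l ⊕ e)) XR.refl F X.𝟙-x J X.geometric)
        (XR.trans (XR.*-cong FJ≈1 X.𝟙-x-⊛-geometric) (X.⊛-identityˡ X.𝟙)))
      scaled : Scaled (dilate F X.⊛ (J X.⊛ X.geometric))
      scaled = scaled-⊛ (dilate-scaled F) (scaled-inverse sB B₀≈1 B⊛Jgeom≈1)
      G≋′ : G X.≋ X.𝟙-x X.⊛ (dilate F X.⊛ (J X.⊛ X.geometric))
      G≋′ = XR.trans G≋ (XR.trans (XR.sym (X.⊛-identityʳ _))
        (XR.trans (XR.*-cong XR.refl (XR.sym X.𝟙-x-⊛-geometric))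
        (solve 4 (λ s j l e → (s ⊕ j) ⊕ (l ⊕ e) ⊜ l ⊕ (s ⊕ (j ⊕ e))) XR.refl (dilate F) J X.𝟙-x X.geometric)))

  -- In odd shape, F_{k+1} = A_{k+1} − A_k is divisible by q^k.
  odd-shape-divisibility : ∀ {F} → OddShape F → ∀ k → Q.VanishBelow k (F (suc k))
  odd-shape-divisibility (A , sA , F≋) k = Q.vanish-resp (QR.sym (QR.trans (F≋ (suc k)) (X.𝟙-x-⊛-suc A k)))
    (Q.vanish-⊕ (Q.vanish-weaken (ℕₚ.n≤1+n k) (sA (suc k))) (Q.vanish-⊖ (sA k)))

open import Data.Integer using (-_; _+_; _*_)
import Data.Integer.Properties as ℤₚ
open import Data.List using ([]; _∷_; map; upTo; zipWith; applyUpTo; drop)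
import Data.List.Properties as Listₚ
open import Relation.Binary.PropositionalEquality

open DoubleSeries ℤₚ.+-*-commutativeRing

⟦_⟧ : Poly → Q.Ser
⟦ p ⟧ = coeff p

⟦_⟧ₛ : Series → X.Ser
⟦ f ⟧ₛ n = ⟦ f n ⟧

coeff-addP : ∀ p p′ i → coeff (addP p p′) i ≡ coeff p i + coeff p′ i
coeff-addP []      p′       i       = sym (ℤₚ.+-identityˡ _)
coeff-addP (a ∷ p) []       i       = sym (ℤₚ.+-identityʳ _)
coeff-addP (a ∷ p) (b ∷ p′) zero    = refl
coeff-addP (a ∷ p) (b ∷ p′) (suc i) = coeff-addP p p′ i

coeff-negP : ∀ p i → coeff (negP p) i ≡ - coeff p i
coeff-negP []      i       = refl
coeff-negP (a ∷ p) zero    = refl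
coeff-negP (a ∷ p) (suc i) = coeff-negP p i

coeff-scaleP : ∀ c p i → coeff (scaleP c p) i ≡ c * coeff p i
coeff-scaleP c []      i       = sym (ℤₚ.*-zeroʳ c)
coeff-scaleP c (a ∷ p) zero    = refl
coeff-scaleP c (a ∷ p) (suc i) = coeff-scaleP c p i

coeff-mulP : ∀ p p′ → ⟦ mulP p p′ ⟧ Q.≋ ⟦ p ⟧ Q.⊛ ⟦ p′ ⟧
coeff-mulP []      p′ i       = sym (Q.⊛-zeroˡ ⟦ p′ ⟧ i)
coeff-mulP (a ∷ p) p′ zero    =
  trans (coeff-addP (scaleP a p′) _ zero) (trans (ℤₚ.+-identityʳ _) (coeff-scaleP a p′ zero))
coeff-mulP (a ∷ p) p′ (suc i) =
  trans (coeff-addP (scaleP a p′) _ (suc i)) (cong₂ _+_ (coeff-scaleP a p′ (suc i)) (coeff-mulP p p′ i))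

coeff-qPow : ∀ k → ⟦ qPow k ⟧ Q.≋ Q.xPow k
coeff-qPow zero    zero    = refl
coeff-qPow zero    (suc i) = refl
coeff-qPow (suc k) zero    = refl
coeff-qPow (suc k) (suc i) = coeff-qPow k i

coeff-drop : ∀ k p j → coeff (drop k p) j ≡ coeff p (k ℕ.+ j)
coeff-drop zero    p       j = refl
coeff-drop (suc k) []      j = refl
coeff-drop (suc k) (a ∷ p) j = coeff-drop k p j

vanish⇒qPow-divides : ∀ k p → Q.VanishBelow k ⟦ p ⟧ → qPow k ∣P p
vanish⇒qPow-divides k p vp = drop k p , λ i → begin
  coeff p i                                   ≡⟨ Q.xPow-factor k vp i ⟩
  (Q.xPow k Q.⊛ (λ j → coeff p (k ℕ.+ j))) i  ≡⟨ Q.⊛-cong (λ j → sym (coeff-qPow k j)) (λ j → sym (coeff-drop k p j)) i ⟩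
  (⟦ qPow k ⟧ Q.⊛ ⟦ drop k p ⟧) i             ≡⟨ sym (coeff-mulP (qPow k) (drop k p) i) ⟩
  coeff (mulP (qPow k) (drop k p)) i          ∎
  where open ≡-Reasoning

mulS-suc : ∀ f g n → mulS f g (suc n) ≡ addP (mulP (f 0) (g (suc n))) (mulS (λ k → f (suc k)) g n)
mulS-suc f g n = begin
  sumP (map (λ k → mulP (f k) (g (suc n ∸ k))) (upTo (suc (suc n))))
    ≡⟨ cong sumP (Listₚ.map-upTo (λ k → mulP (f k) (g (suc n ∸ k))) (suc (suc n))) ⟩
  addP (mulP (f 0) (g (suc n))) (sumP (applyUpTo (λ k → mulP (f (suc k)) (g (n ∸ k))) (suc n)))
    ≡⟨ cong (λ l → addP (mulP (f 0) (g (suc n))) (sumP l))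
            (sym (Listₚ.map-upTo (λ k → mulP (f (suc k)) (g (n ∸ k))) (suc n))) ⟩
  addP (mulP (f 0) (g (suc n))) (mulS (λ k → f (suc k)) g n) ∎
  where open ≡-Reasoning

coeff-mulS : ∀ f g → ⟦ mulS f g ⟧ₛ X.≋ ⟦ f ⟧ₛ X.⊛ ⟦ g ⟧ₛ
coeff-mulS f g zero    i =
  trans (coeff-addP (mulP (f 0) (g 0)) [] i) (trans (ℤₚ.+-identityʳ _) (coeff-mulP (f 0) (g 0) i))
coeff-mulS f g (suc n) i = begin
  coeff (mulS f g (suc n)) i
    ≡⟨ cong (λ l → coeff l i) (mulS-suc f g n) ⟩
  coeff (addP (mulP (f 0) (g (suc n))) (mulS (λ k → f (suc k)) g n)) i
    ≡⟨ coeff-addP (mulP (f 0) (g (suc n))) _ i ⟩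
  coeff (mulP (f 0) (g (suc n))) i + coeff (mulS (λ k → f (suc k)) g n) i
    ≡⟨ cong₂ _+_ (coeff-mulP (f 0) (g (suc n)) i) (coeff-mulS (λ k → f (suc k)) g n i) ⟩
  (⟦ f ⟧ₛ X.⊛ ⟦ g ⟧ₛ) (suc n) i ∎
  where open ≡-Reasoning

coeff-substQ : ∀ f → ⟦ substQ f ⟧ₛ X.≋ dilate ⟦ f ⟧ₛ
coeff-substQ f n i = trans (coeff-mulP (qPow n) (f n) i) (Q.⊛-cong (coeff-qPow n) (λ _ → refl) i)

invRev-coefficients : ∀ f n → invRev f n ≡ applyUpTo (λ k → invS f (n ∸ k)) (suc n)
invRev-coefficients f zero    = refl
invRev-coefficients f (suc n) = cong (invS f (suc n) ∷_) (invRev-coefficients f n)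

zipWith-applyUpTo : {A B C : Set} (h : A → B → C) (a : ℕ → A) (b : ℕ → B) (n : ℕ) →
  zipWith h (applyUpTo a n) (applyUpTo b n) ≡ applyUpTo (λ k → h (a k) (b k)) n
zipWith-applyUpTo h a b zero    = refl
zipWith-applyUpTo h a b (suc n) =
  cong (h (a 0) (b 0) ∷_) (zipWith-applyUpTo h (λ k → a (suc k)) (λ k → b (suc k)) n)

invS-suc : ∀ f n → invS f (suc n) ≡ negP (mulS (λ k → f (suc k)) (invS f) n)
invS-suc f n = cong (λ l → negP (sumP l)) (begin
    zipWith mulP (map (λ k → f (suc k)) (upTo (suc n))) (invRev f n)
  ≡⟨ cong₂ (zipWith mulP) (Listₚ.map-upTo (λ k → f (suc k)) (suc n)) (invRev-coefficients f n) ⟩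
    zipWith mulP (applyUpTo (λ k → f (suc k)) (suc n)) (applyUpTo (λ k → invS f (n ∸ k)) (suc n))
  ≡⟨ zipWith-applyUpTo mulP (λ k → f (suc k)) (λ k → invS f (n ∸ k)) (suc n) ⟩
    applyUpTo (λ k → mulP (f (suc k)) (invS f (n ∸ k))) (suc n)
  ≡⟨ sym (Listₚ.map-upTo (λ k → mulP (f (suc k)) (invS f (n ∸ k))) (suc n)) ⟩
    map (λ k → mulP (f (suc k)) (invS f (n ∸ k))) (upTo (suc n)) ∎)
  where open ≡-Reasoning

coeff-invS-suc : ∀ f n → ⟦ invS f ⟧ₛ (suc n) Q.≋ Q.⊖ ((X.tl ⟦ f ⟧ₛ X.⊛ ⟦ invS f ⟧ₛ) n)
coeff-invS-suc f n i = begin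
  coeff (invS f (suc n)) i                                  ≡⟨ cong (λ l → coeff l i) (invS-suc f n) ⟩
  coeff (negP (mulS (λ k → f (suc k)) (invS f) n)) i        ≡⟨ coeff-negP (mulS (λ k → f (suc k)) (invS f) n) i ⟩
  - coeff (mulS (λ k → f (suc k)) (invS f) n) i             ≡⟨ cong -_ (coeff-mulS (λ k → f (suc k)) (invS f) n i) ⟩
  - (X.tl ⟦ f ⟧ₛ X.⊛ ⟦ invS f ⟧ₛ) n i                       ∎
  where open ≡-Reasoning

invS-inverse : ∀ f → ⟦ f ⟧ₛ 0 Q.≋ Q.𝟙 → ⟦ f ⟧ₛ X.⊛ ⟦ invS f ⟧ₛ X.≋ X.𝟙
invS-inverse f f₀≈1 = X.recursion⇒inverse f₀≈1 starts-with-1 (coeff-invS-suc f)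
  where
  starts-with-1 : ⟦ invS f ⟧ₛ 0 Q.≋ Q.𝟙
  starts-with-1 = coeff-qPow 0

-- F̂ r is F_{r+1}, read in Z[[q]][[x]].
F̂ : ℕ → X.Ser
F̂ r = ⟦ Fsh r ⟧ₛ

F̂-zero : F̂ 0 X.≋ X.𝟙-x
F̂-zero zero                = coeff-qPow 0
F̂-zero (suc zero)    zero    = refl
F̂-zero (suc zero)    (suc i) = refl
F̂-zero (suc (suc n)) i       = refl

F̂-suc : ∀ r → F̂ (suc r) X.≋ dilate (F̂ r) X.⊛ ⟦ invS (Fsh r) ⟧ₛ
F̂-suc r = XR.trans (coeff-mulS (substQ (Fsh r)) (invS (Fsh r))) (XR.*-cong (coeff-substQ (Fsh r)) XR.refl)

F̂-constant : ∀ r → F̂ r 0 Q.≋ Q.𝟙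
F̂-constant zero    = coeff-qPow 0
F̂-constant (suc r) = QR.trans (F̂-suc r 0)
  (QR.trans (QR.*-cong (Q.⊛-identityˡ (F̂ r 0)) (coeff-qPow 0)) (QR.trans (QR.*-identityʳ _) (F̂-constant r)))

module StepAt (r : ℕ) = Step (F̂-constant r) (invS-inverse (Fsh r) (F̂-constant r)) (F̂-suc r)

odd-shape : ∀ m → OddShape (F̂ (2 ℕ.* m))
odd-shape zero    = X.𝟙 , 𝟙-scaled , XR.trans F̂-zero (XR.sym (X.⊛-identityʳ X.𝟙-x))
odd-shape (suc m) = subst (λ r → OddShape (F̂ r)) (sym (ℕₚ.*-suc 2 m))
  (StepAt.even⇒odd (suc (2 ℕ.* m)) (StepAt.odd⇒even (2 ℕ.* m) (odd-shape m)))

corollary4p2 : (r n : ℕ) → 1 ≤ r → Odd r → 1 ≤ n → qPow (n ∸ 1) ∣P chi r n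
corollary4p2 .(suc (2 ℕ.* m)) (suc k) _ (m , refl) _ =
  vanish⇒qPow-divides k (Fsh (2 ℕ.* m) (suc k)) (odd-shape-divisibility (odd-shape m) k)
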